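{- For every positive integer $a$ let $p_a=N_a+3N_{a-2}$ and $q_a=-p_{ -a}$, where $p_{ -a}=N_{ -a}+3N_{ -a-2}$. Then for every integer $m$ with $a<m$, $$N_m=p_aN_{m-a}+q_aN_{m-2a}+N_{m-3a}.$$
   Context: The Narayana numbers $(N_r)_{r\in\mathbb{Z}}$ are defined by $N_0=0$, $N_1=N_2=1$ and $N_r=N_{r-1}+N_{r-3}$ for all integers $r$ (used in both directions, so $N_{ -1}=0$, $N_{ -2}=1$, etc.). -}

module Defs where

open import Data.Nat using (ℕ; zero; suc)
open import Data.Integer using (ℤ; +_; -[1+_]; _+_; _-_; -_)

Nfwd : ℕ → ℤ
Nfwd 0 = + 0
Nfwd 1 = + 1
Nfwd 2 = + 1
Nfwd (suc (suc (suc n))) = Nfwd (suc (suc n)) + Nfwd n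

-- Backward values: Nbwd k = N_{-k}, obtained from the recurrence run
-- backwards, N_{r-3} = N_r - N_{r-1}.
-- Nbwd 0 = N_0 = 0, Nbwd 1 = N_{-1} = N_2 - N_1 = 0, Nbwd 2 = N_{-2} = N_1 - N_0 = 1,
-- Nbwd (k+3) = N_{-k} - N_{-k-1} = Nbwd k - Nbwd (k+1).
Nbwd : ℕ → ℤ
Nbwd 0 = + 0
Nbwd 1 = + 0
Nbwd 2 = + 1
Nbwd (suc (suc (suc k))) = Nbwd k - Nbwd (suc k)

N : ℤ → ℤ
N (+ n) = Nfwd n
N -[1+ k ] = Nbwd (suc k)

p : ℤ → ℤ
p a = N a + + 3 Data.Integer.* N (a - + 2)

q : ℤ → ℤ
q a = - p (- a)

module Submission where

-- The identity is the Cayley–Hamilton theorem in the ring R = ℤ[t, t⁻¹]/(t³ − t² − 1),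
-- on which multiplication by t acts as the companion matrix of the Narayana recurrence.
-- An element u + v·t⁻¹ + w·t of R is stored as a triple ⟨ u , v , w ⟩.  The same triples
-- serve as windows ⟨ N r , N (r+1) , N (r+2) ⟩ of the sequence, and under this
-- identification the window at r is t^(r+2); in particular tⁿ is the window at n − 2.
--
-- It then shows that the recurrence holds
-- at every integer, so that shifting a window by n is multiplication by tⁿ.  Hence
-- trace tⁿ = p n, det tⁿ = 1, and t⁻ⁿ = conj tⁿ is the window at −n−2, whose trace is
-- p (−n) = −q n.  Cayley–Hamilton for c = tᵃ, applied to the window at m − 3a and read in
-- the first coordinate, gives the theorem (for every m and every a ≥ 0).

open import Level using (0ℓ)
open import Algebra.Bundles.Raw using (RawRing)
open import Data.Nat using (ℕ; zero; suc)
import Data.Nat.Properties as ℕ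
open import Data.Fin using (#_)
open import Data.Vec using (Vec; _∷_; [])
open import Relation.Binary.PropositionalEquality
open ≡-Reasoning

record Triple (A : Set) : Set where
  constructor ⟨_,_,_⟩
  field π₀ π₁ π₂ : A
open Triple

-- The ring R = ℤ[t, t⁻¹]/(t³ − t² − 1) written in the basis 1, t⁻¹, t, with coefficients
-- in an arbitrary raw ring so that the same definitions can be evaluated symbolically.
module CubicAlgebra (Ring : RawRing 0ℓ 0ℓ) where
  open RawRing Ring

  private
    infixl 6 _-_
    _-_ : Carrier → Carrier → Carrier
    a - b = a + - b

  infixr 7 _⋆_ _·_
  infixl 6 _⊞_

  -- c ⋆ x applies u·I + v·C⁻¹ + w·C to x, where c = ⟨ u , v , w ⟩ and C is the companion
  -- matrix.  These matrices commute and c ⋆ e = c, so reading x as an element of R as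
  -- well, ⋆ is the product of R.
  _⋆_ : Triple Carrier → Triple Carrier → Triple Carrier
  c ⋆ x = ⟨ u * π₀ x + (w - v) * π₁ x + v * π₂ x
          , v * π₀ x + u * π₁ x + w * π₂ x
          , w * π₀ x + v * π₁ x + (u + w) * π₂ x ⟩
    where u = π₀ c; v = π₁ c; w = π₂ c

  _·_ : Carrier → Triple Carrier → Triple Carrier
  k · x = ⟨ k * π₀ x , k * π₁ x , k * π₂ x ⟩

  _⊞_ : Triple Carrier → Triple Carrier → Triple Carrier
  x ⊞ y = ⟨ π₀ x + π₀ y , π₁ x + π₁ y , π₂ x + π₂ y ⟩

  e t : Triple Carrier
  e = ⟨ 1# , 0# , 0# ⟩
  t = ⟨ 0# , 0# , 1# ⟩

  t^_ : ℕ → Triple Carrier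
  t^ zero = e
  t^ suc n = t^ n ⋆ t

  -- Trace of the matrix of c ⋆_, namely 3u + w.
  trace : Triple Carrier → Carrier
  trace c = π₂ c + (1# + 1# + 1#) * π₀ c

  -- The adjugate of the matrix of c ⋆_ is the matrix of conj c ⋆_.
  conj : Triple Carrier → Triple Carrier
  conj ⟨ u , v , w ⟩ = ⟨ u * (u + w) - v * w , w * w - v * (u + w) , v * v - u * w ⟩

  -- Determinant of the matrix of c ⋆_ (the norm of c), expanded along the first row.
  det : Triple Carrier → Carrier
  det c = π₀ (c ⋆ conj c)

open import Defs
open import Data.Integer
  using (ℤ; +_; -[1+_]; _+_; _-_; _*_; -_; _<_; _>_; +-*-rawRing)
open import Data.Integer.Properties using (+-assoc; +-comm; +-identityʳ)
open import Data.Integer.Tactic.RingSolver using (ring; solve-∀)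
open import Tactic.RingSolver.NonReflective ring
  using (Expr; Κ; Ι; _⊕_; _⊗_; ⊝_; module Ops)
open Ops using (⟦_⟧; ⟦_⇓⟧; prove)

open CubicAlgebra +-*-rawRing

symbolic : RawRing 0ℓ 0ℓ
symbolic = record
  { Carrier = Expr ℤ 9 ; _≈_ = _≡_
  ; _+_ = _⊕_ ; _*_ = _⊗_ ; -_ = ⊝_ ; 0# = Κ (+ 0) ; 1# = Κ (+ 1) }

module S = CubicAlgebra symbolic

X Y Z : Triple (Expr ℤ 9)
X = ⟨ Ι (# 0) , Ι (# 1) , Ι (# 2) ⟩
Y = ⟨ Ι (# 3) , Ι (# 4) , Ι (# 5) ⟩
Z = ⟨ Ι (# 6) , Ι (# 7) , Ι (# 8) ⟩

env : Triple ℤ → Triple ℤ → Triple ℤ → Vec ℤ 9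
env a b c = π₀ a ∷ π₁ a ∷ π₂ a ∷ π₀ b ∷ π₁ b ∷ π₂ b ∷ π₀ c ∷ π₁ c ∷ π₂ c ∷ []

⟦_⟧³ : Triple (Expr ℤ 9) → Vec ℤ 9 → Triple ℤ
⟦ s ⟧³ ρ = ⟨ ⟦ π₀ s ⟧ ρ , ⟦ π₁ s ⟧ ρ , ⟦ π₂ s ⟧ ρ ⟩

triple-≡ : ∀ {A : Set} {a b c a′ b′ c′ : A} →
  a ≡ a′ → b ≡ b′ → c ≡ c′ → ⟨ a , b , c ⟩ ≡ ⟨ a′ , b′ , c′ ⟩
triple-≡ refl refl refl = refl

-- An identity between symbolic triples holds for all integer triples as soon as the
-- normal forms of corresponding coordinates coincide (which is then checked by refl).
ring³ : ∀ a b c (s s′ : Triple (Expr ℤ 9)) → let ρ = env a b c in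
  ⟦ π₀ s ⇓⟧ ρ ≡ ⟦ π₀ s′ ⇓⟧ ρ → ⟦ π₁ s ⇓⟧ ρ ≡ ⟦ π₁ s′ ⇓⟧ ρ → ⟦ π₂ s ⇓⟧ ρ ≡ ⟦ π₂ s′ ⇓⟧ ρ →
  ⟦ s ⟧³ ρ ≡ ⟦ s′ ⟧³ ρ
ring³ a b c s s′ h₀ h₁ h₂ =
  triple-≡ (prove ρ (π₀ s) (π₀ s′) h₀) (prove ρ (π₁ s) (π₁ s′) h₁) (prove ρ (π₂ s) (π₂ s′) h₂)
  where ρ = env a b c

-- The laws of R used below.  In identities involving fewer than three triples the
-- surplus symbolic triples are simply unused.

⋆-identityˡ : ∀ x → e ⋆ x ≡ x
⋆-identityˡ x = ring³ x x x (S.e S.⋆ X) X refl refl refl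

⋆-identityʳ : ∀ c → c ⋆ e ≡ c
⋆-identityʳ c = ring³ c c c (X S.⋆ S.e) X refl refl refl

⋆-assoc : ∀ c d x → c ⋆ (d ⋆ x) ≡ (c ⋆ d) ⋆ x
⋆-assoc c d x = ring³ c d x (X S.⋆ Y S.⋆ Z) ((X S.⋆ Y) S.⋆ Z) refl refl refl

t-⋆ : ∀ x → t ⋆ x ≡ ⟨ π₁ x , π₂ x , π₂ x + π₀ x ⟩
t-⋆ x = ring³ x x x (S.t S.⋆ X) ⟨ π₁ X , π₂ X , π₂ X ⊕ π₀ X ⟩ refl refl refl

conj-⋆ : ∀ c → conj c ⋆ c ≡ det c · e
conj-⋆ c = ring³ c c c (S.conj X S.⋆ X) (S.det X S.· S.e) refl refl refl

det-⋆ : ∀ c d → det (c ⋆ d) ≡ det c * det d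
det-⋆ c d = prove (env c d d) (S.det (X S.⋆ Y)) (S.det X ⊗ S.det Y) refl

-- Cayley–Hamilton for the matrix of c ⋆_:  c³ − tr(c) c² + e₂(c) c − det(c) = 0,
-- where the second elementary symmetric function e₂(c) is the trace of the adjugate.
cayley-hamilton : ∀ c x →
  c ⋆ c ⋆ c ⋆ x ⊞ trace (conj c) · c ⋆ x ≡ trace c · c ⋆ c ⋆ x ⊞ det c · x
cayley-hamilton c x = ring³ c x x
  (X S.⋆ X S.⋆ X S.⋆ Y S.⊞ S.trace (S.conj X) S.· X S.⋆ Y)
  (S.trace X S.· X S.⋆ X S.⋆ Y S.⊞ S.det X S.· Y) refl refl refl

conj-inverse : ∀ c x → c ⋆ x ≡ e → det c ≡ + 1 → x ≡ conj c
conj-inverse c x cx≡e det≡1 = begin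
  x                   ≡⟨ ⋆-identityˡ x ⟨
  e ⋆ x               ≡⟨ cong (λ k → (k · e) ⋆ x) det≡1 ⟨
  (det c · e) ⋆ x     ≡⟨ cong (_⋆ x) (conj-⋆ c) ⟨
  (conj c ⋆ c) ⋆ x    ≡⟨ ⋆-assoc (conj c) c x ⟨
  conj c ⋆ c ⋆ x      ≡⟨ cong (conj c ⋆_) cx≡e ⟩
  conj c ⋆ e          ≡⟨ ⋆-identityʳ (conj c) ⟩
  conj c              ∎

N-rec : ∀ r → N (r + + 3) ≡ N (r + + 2) + N r
N-rec (+ n) rewrite ℕ.+-comm n 3 | ℕ.+-comm n 2 = refl
N-rec -[1+ 0 ] = refl
N-rec -[1+ 1 ] = refl
N-rec -[1+ 2 ] = refl
N-rec -[1+ suc (suc (suc k)) ] = x≡y+[x-y] (Nbwd (suc k)) (Nbwd (suc (suc k)))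
  where
  x≡y+[x-y] : ∀ x y → x ≡ y + (x - y)
  x≡y+[x-y] = solve-∀

-- The window of N at r, i.e. the element t^(r+2) of R.
window : ℤ → Triple ℤ
window r = ⟨ N r , N (r + + 1) , N (r + + 2) ⟩

window-succ : ∀ r → window (r + + 1) ≡ t ⋆ window r
window-succ r = begin
  ⟨ N (r + + 1) , N (r + + 1 + + 1) , N (r + + 1 + + 2) ⟩
    ≡⟨ cong₂ (λ i j → ⟨ N (r + + 1) , N i , N j ⟩) (+-assoc r (+ 1) (+ 1)) (+-assoc r (+ 1) (+ 2)) ⟩
  ⟨ N (r + + 1) , N (r + + 2) , N (r + + 3) ⟩
    ≡⟨ cong (λ z → ⟨ N (r + + 1) , N (r + + 2) , z ⟩) (N-rec r) ⟩
  ⟨ N (r + + 1) , N (r + + 2) , N (r + + 2) + N r ⟩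
    ≡⟨ t-⋆ (window r) ⟨
  t ⋆ window r ∎

window-shift : ∀ n r → window (r + + n) ≡ t^ n ⋆ window r
window-shift zero r = begin
  window (r + + 0) ≡⟨ cong window (+-identityʳ r) ⟩
  window r         ≡⟨ ⋆-identityˡ (window r) ⟨
  e ⋆ window r     ∎
window-shift (suc n) r = begin
  window (r + + suc n)       ≡⟨ cong window (+-assoc r (+ 1) (+ n)) ⟨
  window (r + + 1 + + n)     ≡⟨ window-shift n (r + + 1) ⟩
  t^ n ⋆ window (r + + 1)    ≡⟨ cong (t^ n ⋆_) (window-succ r) ⟩
  t^ n ⋆ t ⋆ window r        ≡⟨ ⋆-assoc (t^ n) t (window r) ⟩
  (t^ n ⋆ t) ⋆ window r      ∎

t^-window : ∀ n → t^ n ≡ window (+ n - + 2)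
t^-window n = begin
  t^ n                       ≡⟨ ⋆-identityʳ (t^ n) ⟨
  t^ n ⋆ window -[1+ 1 ]     ≡⟨ window-shift n -[1+ 1 ] ⟨
  window (-[1+ 1 ] + + n)    ≡⟨ cong window (+-comm -[1+ 1 ] (+ n)) ⟩
  window (+ n - + 2)         ∎

det-t^ : ∀ n → det (t^ n) ≡ + 1
det-t^ zero = refl
det-t^ (suc n) = begin
  det (t^ n ⋆ t)      ≡⟨ det-⋆ (t^ n) t ⟩
  det (t^ n) * det t  ≡⟨ cong (_* det t) (det-t^ n) ⟩
  + 1 * det t         ≡⟨⟩
  + 1                 ∎

conj-t^-window : ∀ n → conj (t^ n) ≡ window (- + n - + 2)
conj-t^-window n = sym (conj-inverse (t^ n) (window (- + n - + 2)) shifted-to-unit (det-t^ n))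
  where
  back-to-−2 : ∀ k → (- k - + 2) + k ≡ - + 2
  back-to-−2 = solve-∀
  shifted-to-unit : t^ n ⋆ window (- + n - + 2) ≡ e
  shifted-to-unit = trans (sym (window-shift n (- + n - + 2))) (cong window (back-to-−2 (+ n)))

p-trace : ∀ k → p k ≡ trace (window (k - + 2))
p-trace k = cong (λ i → N i + + 3 * N (k - + 2)) (k≡[k-2]+2 k)
  where
  k≡[k-2]+2 : ∀ k → k ≡ k - + 2 + + 2
  k≡[k-2]+2 = solve-∀

trace-t^ : ∀ n → trace (t^ n) ≡ p (+ n)
trace-t^ n = trans (cong trace (t^-window n)) (sym (p-trace (+ n)))

trace-conj-t^ : ∀ n → trace (conj (t^ n)) ≡ p (- + n)
trace-conj-t^ n = trans (cong trace (conj-t^-window n)) (sym (p-trace (- + n)))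

window-shift-to : ∀ n r s → r + + n ≡ s → window s ≡ t^ n ⋆ window r
window-shift-to n r .(r + + n) refl = window-shift n r

isolate : ∀ a b c d k l → a + l * c ≡ k * b + + 1 * d → a ≡ k * b + - l * c + d
isolate a b c d k l eq = begin
  a                              ≡⟨ split a l c ⟩
  a + l * c + - l * c            ≡⟨ cong (_+ - l * c) eq ⟩
  k * b + + 1 * d + - l * c      ≡⟨ regroup k b d l c ⟩
  k * b + - l * c + d            ∎
  where
  split : ∀ a l c → a ≡ a + l * c + - l * c
  split = solve-∀
  regroup : ∀ k b d l c → k * b + + 1 * d + - l * c ≡ k * b + - l * c + d
  regroup = solve-∀

-- The theorem for every a = n ≥ 0 and every m: the first coordinate of Cayley–Hamilton
-- for c = tⁿ applied to the window at m − 3n.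
shift-identity : ∀ n m →
  N m ≡ p (+ n) * N (m - + n) + q (+ n) * N (m - + 2 * + n) + N (m - + 3 * + n)
shift-identity n m =
  isolate (N m) (N (m - + n)) (N (m - + 2 * + n)) (N (m - + 3 * + n)) (p (+ n)) (p (- + n)) (begin
  N m + p (- + n) * N (m - + 2 * + n)
    ≡⟨ cong₂ (λ y z → π₀ y + p (- + n) * π₀ z) w₃ w₁ ⟩
  π₀ (c ⋆ c ⋆ c ⋆ x) + p (- + n) * π₀ (c ⋆ x)
    ≡⟨ cong (λ k → π₀ (c ⋆ c ⋆ c ⋆ x) + k * π₀ (c ⋆ x)) (trace-conj-t^ n) ⟨
  π₀ (c ⋆ c ⋆ c ⋆ x ⊞ trace (conj c) · c ⋆ x)
    ≡⟨ cong π₀ (cayley-hamilton c x) ⟩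
  π₀ (trace c · c ⋆ c ⋆ x ⊞ det c · x)
    ≡⟨ cong₂ (λ k y → k * π₀ y + det c * π₀ x) (trace-t^ n) (sym w₂) ⟩
  p (+ n) * N (m - + n) + det c * N (m - + 3 * + n)
    ≡⟨ cong (λ k → p (+ n) * N (m - + n) + k * N (m - + 3 * + n)) (det-t^ n) ⟩
  p (+ n) * N (m - + n) + + 1 * N (m - + 3 * + n) ∎)
  where
  c = t^ n
  x = window (m - + 3 * + n)
  [m-3k]+k : ∀ m k → m - + 3 * k + k ≡ m - + 2 * k
  [m-3k]+k = solve-∀
  [m-2k]+k : ∀ m k → m - + 2 * k + k ≡ m - k
  [m-2k]+k = solve-∀
  [m-k]+k : ∀ m k → m - k + k ≡ m
  [m-k]+k = solve-∀
  w₁ : window (m - + 2 * + n) ≡ c ⋆ x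
  w₁ = window-shift-to n (m - + 3 * + n) (m - + 2 * + n) ([m-3k]+k m (+ n))
  w₂ : window (m - + n) ≡ c ⋆ c ⋆ x
  w₂ = trans (window-shift-to n (m - + 2 * + n) (m - + n) ([m-2k]+k m (+ n))) (cong (c ⋆_) w₁)
  w₃ : window m ≡ c ⋆ c ⋆ c ⋆ x
  w₃ = trans (window-shift-to n (m - + n) m ([m-k]+k m (+ n))) (cong (c ⋆_) w₂)

-- The identity holds for every m and every a ≥ 0 (shift-identity).
theorem3 : (a : ℤ) → a > + 0 → (m : ℤ) → a < m →
    N m ≡ p a * N (m - a) + q a * N (m - + 2 * a) + N (m - + 3 * a)
theorem3 (+ n) _ m _ = shift-identity n m
theorem3 -[1+ _ ] () _ _
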